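{- Let $R$ be a commutative ring, $A,r\in R$, and let $f:\mathbb{Z}\times\mathbb{Z}\to R$ satisfy $f(n,k)=f(n-1,k)+f(n-1,k-1)$ for all $n,k\in\mathbb{Z}$. Suppose $f(0,d)=A\,\delta_{0,d}$ for all $d\in\mathbb{Z}$ and $f(c,0)=Ar$ for all integers $c<0$. Then for all $c,d\in\mathbb{Z}$, $$f(c,d)=\begin{cases}A\binom cd & c,d\ge0,\\ A\binom cd r & c<0\le d,\\ A\binom c{c-d}(1-r) & c<0\le c-d,\\ 0&\text{otherwise.}\end{cases}$$
   Context: $\delta_{0,d}$ is the Kronecker delta. For $c\in\mathbb{Z}$ and an integer $d\ge0$, $\binom cd:=c(c-1)\cdots(c-d+1)/d!$ (an integer, viewed in $R$). -}

module Defs where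

open import Level using (Level)
open import Data.Nat as ℕ using (ℕ; zero; suc; _!)
open import Data.Nat.Properties using (_!≢0)
open import Data.Integer as ℤ using (ℤ; +_; -[1+_])
open import Data.Integer.DivMod using (_/ℕ_)
open import Algebra.Bundles using (CommutativeRing; Semiring)

falling : ℤ → ℕ → ℤ
falling c zero    = ℤ.1ℤ
falling c (suc d) = c ℤ.* falling (c ℤ.- ℤ.1ℤ) d

-- generalized binomial coefficient  binom c d = c(c-1)...(c-d+1)/d!  (exact division)
binom : ℤ → ℕ → ℤ
binom c d = _/ℕ_ (falling c d) (d !) {{d !≢0}}

module _ {c ℓ : Level} (R : CommutativeRing c ℓ) where
  open CommutativeRing R
  open import Algebra.Definitions.RawSemiring (Semiring.rawSemiring semiring) using (_×_)

  ℤ⇒ : ℤ → Carrier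
  ℤ⇒ (+ n)      = n × 1#
  ℤ⇒ -[1+ n ]   = - (suc n × 1#)

  δ₀ : ℤ → Carrier
  δ₀ (+ zero)  = 1#
  δ₀ (+ suc _) = 0#
  δ₀ -[1+ _ ]  = 0#

{-# OPTIONS --safe #-}
module Submission where

open import Defs
open import Level using (Level)
open import Data.Nat using (ℕ)
open import Data.Integer as ℤ using (ℤ; _≤_; _<_; 0ℤ; 1ℤ; ∣_∣)
open import Data.Product using (_×_)
open import Relation.Nullary using (¬_)
open import Algebra.Bundles using (CommutativeRing)

open import Data.Nat as ℕ using (zero; suc; _!; s≤s; z≤n)
import Data.Nat.Properties as ℕ
open import Data.Nat.Properties using (_!≢0)
open import Data.Integer using (+_; -[1+_]; +≤+; +<+; -<+)
import Data.Integer.Properties as ℤ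
open import Data.Integer.DivMod using (_/ℕ_; [n/ℕd]*d≤n; n<s[n/ℕd]*d)
open import Data.Product using (_,_)
open import Data.Empty using (⊥-elim)
open import Relation.Nullary using (yes; no)
open import Algebra.Bundles using (Group; AbelianGroup)
open import Algebra.Definitions using (Congruent₁)
open import Relation.Binary.PropositionalEquality as ≡ using (_≡_; refl)

-- Regard f as Pascal's triangle continued to all rows c ∈ ℤ: by the recurrence each row
-- arises from the previous one by Pascal's rule, as does every array (c, k) ↦ A binom(c, k) s.
-- Two such arrays agreeing on one row and at k = 0 of the next (or of the previous) row agree
-- on that row as well.  Inducting upwards from row 0 with s = 1, and downwards with s = r
-- (since f(c, 0) = A r for c < 0), gives the entries with d ≥ 0.  In the coordinates
-- (c, c − d) the recurrence is again Pascal's rule, so the downward induction with s = 1 − r,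
-- started from the diagonal value f(c, c) = A (1 − r), gives d ≤ c < 0; the remaining entries
-- vanish by a direct induction.  Pascal's rule for binom itself holds because the falling
-- factorials and k! times an integer Pascal triangle obey the same rule weighted by k + 1,
-- so they coincide and the division by k! is exact.

-[1+m]-1≡-[2+m] : ∀ m → -[1+ m ] ℤ.- 1ℤ ≡ -[1+ suc m ]
-[1+m]-1≡-[2+m] m = ≡.cong (λ n → -[1+ suc n ]) (ℕ.+-identityʳ m)

-m-1≡-[1+m] : ∀ m → ℤ.- + m ℤ.- 1ℤ ≡ -[1+ m ]
-m-1≡-[1+m] zero    = refl
-m-1≡-[1+m] (suc m) = -[1+m]-1≡-[2+m] m

i-∣i-j∣≡j : ∀ i j → 0ℤ ≤ i ℤ.- j → i ℤ.- + ∣ i ℤ.- j ∣ ≡ j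
i-∣i-j∣≡j i j 0≤i-j rewrite ℤ.0≤i⇒+∣i∣≡i 0≤i-j = i-[i-j]≡j i j
  where
  open import Data.Integer.Tactic.RingSolver using (solve-∀)
  i-[i-j]≡j : ∀ i j → i ℤ.- (i ℤ.- j) ≡ j
  i-[i-j]≡j = solve-∀

module PascalArrays {a ℓ} (G : Group a ℓ) where
  open Group G
  open import Algebra.Properties.Group G using (∙-cancelʳ)
  open import Relation.Binary.Reasoning.Setoid setoid

  record PascalStep (g : ℕ → Carrier → Carrier) (x y : ℕ → Carrier) : Set ℓ where
    constructor pascalStep
    field rule : ∀ k → y (suc k) ≈ x (suc k) ∙ g k (x k)

  PascalArray : (ℕ → Carrier → Carrier) → (ℤ → ℕ → Carrier) → Set ℓ
  PascalArray g u = ∀ c → PascalStep g (u (c ℤ.- 1ℤ)) (u c)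

  unweighted : ℕ → Carrier → Carrier
  unweighted _ x = x

  unweighted-cong : ∀ k → Congruent₁ _≈_ (unweighted k)
  unweighted-cong _ x≈y = x≈y

  module _ {g : ℕ → Carrier → Carrier} (g-cong : ∀ k → Congruent₁ _≈_ (g k)) where

    module _ {x y x′ y′ : ℕ → Carrier} (s : PascalStep g x y) (s′ : PascalStep g x′ y′) where
      open PascalStep s using (rule)
      open PascalStep s′ using () renaming (rule to rule′)

      pascalStep-next-unique : (∀ k → x k ≈ x′ k) → y 0 ≈ y′ 0 → ∀ k → y k ≈ y′ k
      pascalStep-next-unique x≈x′ y₀ zero    = y₀
      pascalStep-next-unique x≈x′ y₀ (suc k) = begin
        y (suc k)                ≈⟨ rule k ⟩
        x (suc k) ∙ g k (x k)    ≈⟨ ∙-cong (x≈x′ (suc k)) (g-cong k (x≈x′ k)) ⟩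
        x′ (suc k) ∙ g k (x′ k)  ≈⟨ rule′ k ⟨
        y′ (suc k)               ∎

      pascalStep-previous-unique : (∀ k → y (suc k) ≈ y′ (suc k)) → x 0 ≈ x′ 0 → ∀ k → x k ≈ x′ k
      pascalStep-previous-unique y≈y′ x₀ zero    = x₀
      pascalStep-previous-unique y≈y′ x₀ (suc k) = ∙-cancelʳ (g k (x k)) _ _ (begin
        x (suc k) ∙ g k (x k)    ≈⟨ rule k ⟨
        y (suc k)                ≈⟨ y≈y′ k ⟩
        y′ (suc k)               ≈⟨ rule′ k ⟩
        x′ (suc k) ∙ g k (x′ k)  ≈⟨ ∙-congˡ (g-cong k (pascalStep-previous-unique y≈y′ x₀ k)) ⟨
        x′ (suc k) ∙ g k (x k)   ∎)

    module _ {u v : ℤ → ℕ → Carrier} (su : PascalArray g u) (sv : PascalArray g v) where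

      pascalArray-unique-nonneg : (∀ k → u 0ℤ k ≈ v 0ℤ k) → (∀ n → u (+ suc n) 0 ≈ v (+ suc n) 0) →
                                  ∀ n k → u (+ n) k ≈ v (+ n) k
      pascalArray-unique-nonneg row₀ column₀ zero    = row₀
      pascalArray-unique-nonneg row₀ column₀ (suc n) =
        pascalStep-next-unique (su (+ suc n)) (sv (+ suc n))
          (pascalArray-unique-nonneg row₀ column₀ n) (column₀ n)

      pascalArray-unique-neg : (∀ k → u 0ℤ (suc k) ≈ v 0ℤ (suc k)) →
                               (∀ m → u -[1+ m ] 0 ≈ v -[1+ m ] 0) →
                               ∀ m k → u -[1+ m ] k ≈ v -[1+ m ] k
      pascalArray-unique-neg row₀ column₀ m =
        pascalStep-previous-unique (into-negative su m) (into-negative sv m) (next-row m) (column₀ m)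
        where
        into-negative : ∀ {w} → PascalArray g w → ∀ m → PascalStep g (w -[1+ m ]) (w (ℤ.- + m))
        into-negative {w} sw m =
          ≡.subst (λ c → PascalStep g (w c) (w (ℤ.- + m))) (-m-1≡-[1+m] m) (sw (ℤ.- + m))
        next-row : ∀ m k → u (ℤ.- + m) (suc k) ≈ v (ℤ.- + m) (suc k)
        next-row zero    = row₀
        next-row (suc m) k = pascalArray-unique-neg row₀ column₀ m (suc k)

      pascalArray-unique : (∀ k → u 0ℤ k ≈ v 0ℤ k) → (∀ c → u c 0 ≈ v c 0) → ∀ c k → u c k ≈ v c k
      pascalArray-unique row₀ column₀ (+ n)    =
        pascalArray-unique-nonneg row₀ (λ n → column₀ (+ suc n)) n
      pascalArray-unique row₀ column₀ -[1+ m ] =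
        pascalArray-unique-neg (λ k → row₀ (suc k)) (λ m → column₀ -[1+ m ]) m

module _ where
  open import Data.Integer using (_+_; _-_; _*_; -_)
  open import Data.Integer.Tactic.RingSolver using (solve-∀)
  open PascalArrays (AbelianGroup.group ℤ.+-0-abelianGroup)

  -- Rows c < 0 are obtained from row c + 1 by solving Pascal's rule backwards.
  pascal : ℤ → ℕ → ℤ
  pascal c            zero    = 1ℤ
  pascal (+ zero)     (suc k) = 0ℤ
  pascal (+ suc n)    (suc k) = pascal (+ n) (suc k) + pascal (+ n) k
  pascal -[1+ zero ]  (suc k) = - pascal -[1+ 0 ] k
  pascal -[1+ suc m ] (suc k) = pascal -[1+ m ] (suc k) - pascal -[1+ suc m ] k

  pascal-rec : ∀ c k → pascal c (suc k) ≡ pascal (c - 1ℤ) (suc k) + pascal (c - 1ℤ) k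
  pascal-rec (+ zero)  k = ≡.sym (ℤ.+-inverseˡ (pascal -[1+ 0 ] k))
  pascal-rec (+ suc n) k = refl
  pascal-rec -[1+ m ]  k =
    ≡.subst (λ c → pascal -[1+ m ] (suc k) ≡ pascal c (suc k) + pascal c k) (≡.sym (-[1+m]-1≡-[2+m] m))
      (i≡i-j+j (pascal -[1+ m ] (suc k)) (pascal -[1+ suc m ] k))
    where
    i≡i-j+j : ∀ i j → i ≡ (i - j) + j
    i≡i-j+j = solve-∀

  falling-suc : ∀ c k → falling c (suc k) ≡ falling c k * (c - + k)
  falling-suc c zero    = c*1≡1*[c-0] c
    where
    c*1≡1*[c-0] : ∀ c → c * 1ℤ ≡ 1ℤ * (c - 0ℤ)
    c*1≡1*[c-0] = solve-∀
  falling-suc c (suc k) = begin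
    c * falling (c - 1ℤ) (suc k)              ≡⟨ ≡.cong (c *_) (falling-suc (c - 1ℤ) k) ⟩
    c * (falling (c - 1ℤ) k * (c - 1ℤ - + k)) ≡⟨ reassoc c (falling (c - 1ℤ) k) (+ k) ⟩
    c * falling (c - 1ℤ) k * (c - + suc k)    ∎
    where
    open ≡.≡-Reasoning
    reassoc : ∀ c x k → c * (x * (c - 1ℤ - k)) ≡ c * x * (c - (1ℤ + k))
    reassoc = solve-∀

  falling-rec : ∀ c k → falling c (suc k) ≡ falling (c - 1ℤ) (suc k) + + suc k * falling (c - 1ℤ) k
  falling-rec c k = begin
    c * x                                  ≡⟨ split c x (+ k) ⟩
    x * (c - 1ℤ - + k) + + suc k * x       ≡⟨ ≡.cong (_+ + suc k * x) (falling-suc (c - 1ℤ) k) ⟨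
    falling (c - 1ℤ) (suc k) + + suc k * x ∎
    where
    open ≡.≡-Reasoning
    x = falling (c - 1ℤ) k
    split : ∀ c x k → c * x ≡ x * (c - 1ℤ - k) + (1ℤ + k) * x
    split = solve-∀

  falling-weight : ℕ → ℤ → ℤ
  falling-weight k z = + suc k * z

  falling-weight-cong : ∀ k → Congruent₁ _≡_ (falling-weight k)
  falling-weight-cong k = ≡.cong (falling-weight k)

  falling-step : PascalArray falling-weight falling
  falling-step c = pascalStep (falling-rec c)

  pascal*!-step : PascalArray falling-weight (λ c k → pascal c k * + (k !))
  pascal*!-step c = pascalStep rule
    where
    distrib : ∀ x y s f → (x + y) * (s * f) ≡ x * (s * f) + s * (y * f)
    distrib = solve-∀
    rule : ∀ k → pascal c (suc k) * + (suc k !) ≡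
                 pascal (c - 1ℤ) (suc k) * + (suc k !) + falling-weight k (pascal (c - 1ℤ) k * + (k !))
    rule k = begin
      pascal c (suc k) * + (suc k !)                   ≡⟨ ≡.cong₂ _*_ (pascal-rec c k) [1+k]!≡[1+k]*k! ⟩
      (x + y) * (+ suc k * + (k !))                    ≡⟨ distrib x y (+ suc k) (+ (k !)) ⟩
      x * (+ suc k * + (k !)) + falling-weight k (y * + (k !))
        ≡⟨ ≡.cong (λ z → x * z + falling-weight k (y * + (k !))) [1+k]!≡[1+k]*k! ⟨
      x * + (suc k !) + falling-weight k (y * + (k !)) ∎
      where
      open ≡.≡-Reasoning
      x = pascal (c - 1ℤ) (suc k)
      y = pascal (c - 1ℤ) k
      [1+k]!≡[1+k]*k! : + (suc k !) ≡ + suc k * + (k !)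
      [1+k]!≡[1+k]*k! = ℤ.pos-* (suc k) (k !)

  falling≡pascal*! : ∀ c k → falling c k ≡ pascal c k * + (k !)
  falling≡pascal*! = pascalArray-unique falling-weight-cong falling-step pascal*!-step row₀ (λ _ → refl)
    where
    row₀ : ∀ k → falling 0ℤ k ≡ pascal 0ℤ k * + (k !)
    row₀ zero    = refl
    row₀ (suc k) = refl

  [i*n]/ℕn≡i : ∀ i n .{{_ : ℕ.NonZero n}} → (i * + n) /ℕ n ≡ i
  [i*n]/ℕn≡i i n@(suc _) = ℤ.≤-antisym q≤i i≤q
    where
    q = (i * + n) /ℕ n
    q≤i : q ≤ i
    q≤i = ℤ.*-cancelʳ-≤-pos q i (+ n) ([n/ℕd]*d≤n (i * + n) n)
    i≤q : i ≤ q
    i≤q = ℤ.≮⇒≥ λ q<i → ℤ.<⇒≱ (n<s[n/ℕd]*d (i * + n) n)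
            (ℤ.*-monoʳ-≤-nonNeg (+ n) (ℤ.i<j⇒suc[i]≤j q<i))

  binom≡pascal : ∀ c k → binom c k ≡ pascal c k
  binom≡pascal c k = ≡.trans (≡.cong (λ x → (x /ℕ k !) {{k !≢0}}) (falling≡pascal*! c k))
                             ([i*n]/ℕn≡i (pascal c k) (k !) {{k !≢0}})

  binom-rec : ∀ c k → binom c (suc k) ≡ binom (c - 1ℤ) (suc k) + binom (c - 1ℤ) k
  binom-rec c k
    rewrite binom≡pascal c (suc k) | binom≡pascal (c - 1ℤ) (suc k) | binom≡pascal (c - 1ℤ) k =
    pascal-rec c k

module _ {c ℓ : Level} (R : CommutativeRing c ℓ) where
  open CommutativeRing R hiding (refl)
  open import Algebra.Properties.Monoid.Mult +-monoid using (×-homo-+)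
  open import Algebra.Properties.CommutativeSemigroup +-commutativeSemigroup using (x∙yz≈y∙xz)
  open import Algebra.Properties.Group +-group using (x≈z//y; ∙-cancelˡ)
  open import Algebra.Properties.AbelianGroup +-abelianGroup using (⁻¹-∙-comm)
  open import Relation.Binary.Reasoning.Setoid setoid
  open PascalArrays +-group

  ℤ⇒[m⊖n]+n≈m : ∀ m n → ℤ⇒ R (m ℤ.⊖ n) + ℤ⇒ R (+ n) ≈ ℤ⇒ R (+ m)
  ℤ⇒[m⊖n]+n≈m zero    zero    = +-identityˡ 0#
  ℤ⇒[m⊖n]+n≈m zero    (suc n) = -‿inverseˡ _
  ℤ⇒[m⊖n]+n≈m (suc m) zero    = +-identityʳ _
  ℤ⇒[m⊖n]+n≈m (suc m) (suc n) = begin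
    ℤ⇒ R (suc m ℤ.⊖ suc n) + (1# + ℤ⇒ R (+ n))
      ≡⟨ ≡.cong (λ i → ℤ⇒ R i + (1# + ℤ⇒ R (+ n))) (ℤ.[1+m]⊖[1+n]≡m⊖n m n) ⟩
    ℤ⇒ R (m ℤ.⊖ n) + (1# + ℤ⇒ R (+ n))  ≈⟨ x∙yz≈y∙xz _ 1# _ ⟩
    1# + (ℤ⇒ R (m ℤ.⊖ n) + ℤ⇒ R (+ n))  ≈⟨ +-congˡ (ℤ⇒[m⊖n]+n≈m m n) ⟩
    1# + ℤ⇒ R (+ m)                     ∎

  ℤ⇒-homo-+ : ∀ i j → ℤ⇒ R (i ℤ.+ j) ≈ ℤ⇒ R i + ℤ⇒ R j
  ℤ⇒-homo-+ -[1+ m ] -[1+ n ] = begin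
    - ℤ⇒ R (+ suc (suc (m ℕ.+ n)))      ≡⟨ ≡.cong (λ k → - ℤ⇒ R (+ suc k)) (ℕ.+-suc m n) ⟨
    - ℤ⇒ R (+ (suc m ℕ.+ suc n))        ≈⟨ -‿cong (×-homo-+ 1# (suc m) (suc n)) ⟩
    - (ℤ⇒ R (+ suc m) + ℤ⇒ R (+ suc n)) ≈⟨ ⁻¹-∙-comm _ _ ⟨
    - ℤ⇒ R (+ suc m) + - ℤ⇒ R (+ suc n) ∎
  ℤ⇒-homo-+ -[1+ m ] (+ n)    = trans (x≈z//y _ _ _ (ℤ⇒[m⊖n]+n≈m n (suc m))) (+-comm _ _)
  ℤ⇒-homo-+ (+ m)    -[1+ n ] = x≈z//y _ _ _ (ℤ⇒[m⊖n]+n≈m m (suc n))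
  ℤ⇒-homo-+ (+ m)    (+ n)    = ×-homo-+ 1# m n

  ℤ⇒-binom-rec : ∀ c k → ℤ⇒ R (binom c (suc k)) ≈
                 ℤ⇒ R (binom (c ℤ.- 1ℤ) (suc k)) + ℤ⇒ R (binom (c ℤ.- 1ℤ) k)
  ℤ⇒-binom-rec c k = trans (reflexive (≡.cong (ℤ⇒ R) (binom-rec c k)))
                           (ℤ⇒-homo-+ (binom (c ℤ.- 1ℤ) (suc k)) (binom (c ℤ.- 1ℤ) k))

  cancel-summand : ∀ {x y z y′ z′} → x ≈ y + z → x ≈ y′ + z′ → y ≈ y′ → z ≈ z′
  cancel-summand x≈y+z x≈y′+z′ y≈y′ =
    ∙-cancelˡ _ _ _ (trans (sym x≈y+z) (trans x≈y′+z′ (+-congʳ (sym y≈y′))))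

  module Solution (A r : Carrier) (f : ℤ → ℤ → Carrier)
    (f-rec     : ∀ n k → f n k ≈ f (n ℤ.- 1ℤ) k + f (n ℤ.- 1ℤ) (k ℤ.- 1ℤ))
    (f-row₀    : ∀ d → f 0ℤ d ≈ A * δ₀ R d)
    (f-column₀ : ∀ c′ → c′ < 0ℤ → f c′ 0ℤ ≈ A * r) where

    binomialArray : Carrier → ℤ → ℕ → Carrier
    binomialArray s c k = A * ℤ⇒ R (binom c k) * s

    binomialArray-step : ∀ s → PascalArray unweighted (binomialArray s)
    binomialArray-step s c = pascalStep λ k → begin
      A * ℤ⇒ R (binom c (suc k)) * s                            ≈⟨ *-congʳ (*-congˡ (ℤ⇒-binom-rec c k)) ⟩
      A * (ℤ⇒ R (binom c′ (suc k)) + ℤ⇒ R (binom c′ k)) * s     ≈⟨ *-congʳ (distribˡ A _ _) ⟩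
      (A * ℤ⇒ R (binom c′ (suc k)) + A * ℤ⇒ R (binom c′ k)) * s ≈⟨ distribʳ s _ _ ⟩
      binomialArray s c′ (suc k) + binomialArray s c′ k         ∎
      where c′ = c ℤ.- 1ℤ

    binomialArray-column₀ : ∀ s c → binomialArray s c 0 ≈ A * s
    binomialArray-column₀ s c = *-congʳ (trans (*-congˡ (+-identityʳ 1#)) (*-identityʳ A))

    binomialArray-row₀ : ∀ s k → binomialArray s 0ℤ (suc k) ≈ 0#
    binomialArray-row₀ s k = begin
      A * ℤ⇒ R (binom 0ℤ (suc k)) * s ≡⟨ ≡.cong (λ b → A * ℤ⇒ R b * s) (binom≡pascal 0ℤ (suc k)) ⟩
      A * 0# * s                      ≈⟨ *-congʳ (zeroʳ A) ⟩
      0# * s                          ≈⟨ zeroˡ s ⟩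
      0#                              ∎

    f-row₀-vanishes : ∀ {d} → δ₀ R d ≡ 0# → f 0ℤ d ≈ 0#
    f-row₀-vanishes δ≡0 = trans (f-row₀ _) (trans (*-congˡ (reflexive δ≡0)) (zeroʳ A))

    f-rec-at : ∀ {n n′ k k′} → n ℤ.- 1ℤ ≡ n′ → k ℤ.- 1ℤ ≡ k′ → f n k ≈ f n′ k + f n′ k′
    f-rec-at refl refl = f-rec _ _

    f-from-0 : ℤ → ℕ → Carrier
    f-from-0 c k = f c (+ k)

    f-from-0-step : PascalArray unweighted f-from-0
    f-from-0-step c = pascalStep λ k → f-rec c (+ suc k)

    f-from-diagonal : ℤ → ℕ → Carrier
    f-from-diagonal c t = f c (c ℤ.- + t)

    f-from-diagonal-step : PascalArray unweighted f-from-diagonal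
    f-from-diagonal-step c = pascalStep λ t → begin
      f c (c ℤ.- + suc t)                          ≈⟨ f-rec-at refl (shift₂ c (+ t)) ⟩
      f c′ (c ℤ.- + suc t) + f c′ (c′ ℤ.- + suc t)
        ≡⟨ ≡.cong (λ d → f c′ d + f c′ (c′ ℤ.- + suc t)) (shift₁ c (+ t)) ⟩
      f c′ (c′ ℤ.- + t) + f c′ (c′ ℤ.- + suc t)    ≈⟨ +-comm _ _ ⟩
      f c′ (c′ ℤ.- + suc t) + f c′ (c′ ℤ.- + t)    ∎
      where
      open import Data.Integer.Tactic.RingSolver using (solve-∀)
      c′ = c ℤ.- 1ℤ
      shift₁ : ∀ c t → c ℤ.- (1ℤ ℤ.+ t) ≡ c ℤ.- 1ℤ ℤ.- t
      shift₁ = solve-∀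
      shift₂ : ∀ c t → c ℤ.- (1ℤ ℤ.+ t) ℤ.- 1ℤ ≡ c ℤ.- 1ℤ ℤ.- (1ℤ ℤ.+ t)
      shift₂ = solve-∀

    f-nonneg-neg : ∀ n j → f (+ n) -[1+ j ] ≈ 0#
    f-nonneg-neg zero    j = f-row₀-vanishes refl
    f-nonneg-neg (suc n) j =
      trans (f-rec _ _) (trans (+-cong (f-nonneg-neg n j) (f-nonneg-neg n _)) (+-identityʳ 0#))

    f-nonneg-column₀ : ∀ n → f (+ n) 0ℤ ≈ A * 1#
    f-nonneg-column₀ zero    = f-row₀ 0ℤ
    f-nonneg-column₀ (suc n) =
      trans (f-rec _ _) (trans (+-cong (f-nonneg-column₀ n) (f-nonneg-neg n 0)) (+-identityʳ _))

    f-between-diagonal-and-0 : ∀ m j → j ℕ.< m → f -[1+ m ] -[1+ j ] ≈ 0#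
    f-between-diagonal-and-0 (suc m) zero    _         =
      cancel-summand (f-rec-at (-[1+m]-1≡-[2+m] m) refl)
        (trans (f-column₀ _ -<+) (sym (+-identityʳ _))) (f-column₀ _ -<+)
    f-between-diagonal-and-0 (suc m) (suc j) (s≤s j<m) =
      cancel-summand (f-rec-at (-[1+m]-1≡-[2+m] m) (-[1+m]-1≡-[2+m] j))
        (trans (f-between-diagonal-and-0 m j j<m) (sym (+-identityʳ 0#)))
        (f-between-diagonal-and-0 (suc m) j (ℕ.m<n⇒m<1+n j<m))

    f-diagonal : ∀ m → f -[1+ m ] -[1+ m ] ≈ A * (1# + - r)
    f-diagonal zero    = cancel-summand (f-rec 0ℤ 0ℤ) (trans (f-row₀ 0ℤ) split) (f-column₀ _ -<+)
      where
      split : A * 1# ≈ A * r + A * (1# + - r)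
      split = begin
        A * 1#                  ≈⟨ *-congˡ (+-identityʳ 1#) ⟨
        A * (1# + 0#)           ≈⟨ *-congˡ (+-congˡ (-‿inverseʳ r)) ⟨
        A * (1# + (r + - r))    ≈⟨ *-congˡ (x∙yz≈y∙xz 1# r (- r)) ⟩
        A * (r + (1# + - r))    ≈⟨ distribˡ A r _ ⟩
        A * r + A * (1# + - r)  ∎
    f-diagonal (suc m) =
      cancel-summand (f-rec-at (-[1+m]-1≡-[2+m] m) (-[1+m]-1≡-[2+m] m))
        (trans (f-diagonal m) (sym (+-identityˡ _))) (f-between-diagonal-and-0 (suc m) m (ℕ.n<1+n m))

    f-nonneg-nonneg : ∀ n k → f (+ n) (+ k) ≈ binomialArray 1# (+ n) k
    f-nonneg-nonneg = pascalArray-unique-nonneg unweighted-cong f-from-0-step (binomialArray-step 1#) row₀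
      (λ n → trans (f-nonneg-column₀ (suc n)) (sym (binomialArray-column₀ 1# (+ suc n))))
      where
      row₀ : ∀ k → f 0ℤ (+ k) ≈ binomialArray 1# 0ℤ k
      row₀ zero    = trans (f-row₀ 0ℤ) (sym (binomialArray-column₀ 1# 0ℤ))
      row₀ (suc k) = trans (f-row₀-vanishes refl) (sym (binomialArray-row₀ 1# k))

    f-neg-nonneg : ∀ m k → f -[1+ m ] (+ k) ≈ binomialArray r -[1+ m ] k
    f-neg-nonneg = pascalArray-unique-neg unweighted-cong f-from-0-step (binomialArray-step r)
      (λ k → trans (f-row₀-vanishes refl) (sym (binomialArray-row₀ r k)))
      (λ m → trans (f-column₀ _ -<+) (sym (binomialArray-column₀ r -[1+ m ])))

    f-neg-below-diagonal : ∀ m t → f -[1+ m ] (-[1+ m ] ℤ.- + t) ≈ binomialArray (1# + - r) -[1+ m ] t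
    f-neg-below-diagonal = pascalArray-unique-neg unweighted-cong f-from-diagonal-step (binomialArray-step _)
      (λ t → trans (f-row₀-vanishes refl) (sym (binomialArray-row₀ _ t)))
      (λ m → trans (f-diagonal m) (sym (binomialArray-column₀ _ -[1+ m ])))

    f≈binom : ∀ c d → 0ℤ ≤ c → 0ℤ ≤ d → f c d ≈ A * ℤ⇒ R (binom c ∣ d ∣)
    f≈binom (+ n) (+ k)    _ _  = trans (f-nonneg-nonneg n k) (*-identityʳ _)
    f≈binom (+ _) -[1+ _ ] _ ()

    f≈binom*r : ∀ c d → c < 0ℤ → 0ℤ ≤ d → f c d ≈ A * ℤ⇒ R (binom c ∣ d ∣) * r
    f≈binom*r -[1+ m ] (+ k)    _        _  = f-neg-nonneg m k
    f≈binom*r -[1+ m ] -[1+ _ ] _        ()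
    f≈binom*r (+ _)    _        (+<+ ()) _

    f≈binom*[1-r] : ∀ c d → c < 0ℤ → 0ℤ ≤ c ℤ.- d →
                    f c d ≈ A * ℤ⇒ R (binom c ∣ c ℤ.- d ∣) * (1# + - r)
    f≈binom*[1-r] -[1+ m ] d _ 0≤c-d =
      ≡.subst (λ d′ → f -[1+ m ] d′ ≈ binomialArray (1# + - r) -[1+ m ] ∣ -[1+ m ] ℤ.- d ∣)
              (i-∣i-j∣≡j -[1+ m ] d 0≤c-d) (f-neg-below-diagonal m ∣ -[1+ m ] ℤ.- d ∣)
    f≈binom*[1-r] (+ _)    _ (+<+ ()) _

    f≈0 : ∀ c d → ¬ (0ℤ ≤ c × 0ℤ ≤ d) → ¬ (c < 0ℤ × 0ℤ ≤ d) → ¬ (c < 0ℤ × 0ℤ ≤ c ℤ.- d) →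
          f c d ≈ 0#
    f≈0 (+ _)    (+ _)    ¬nonneg _ _  = ⊥-elim (¬nonneg (+≤+ z≤n , +≤+ z≤n))
    f≈0 (+ n)    -[1+ j ] _ _ _        = f-nonneg-neg n j
    f≈0 -[1+ _ ] (+ _)    _ ¬upper _   = ⊥-elim (¬upper (-<+ , +≤+ z≤n))
    f≈0 -[1+ m ] -[1+ j ] _ _ ¬lower with j ℕ.<? m
    ... | yes j<m = f-between-diagonal-and-0 m j j<m
    ... | no  j≮m = ⊥-elim (¬lower (-<+ , 0≤c-d))
      where
      0≤c-d : 0ℤ ≤ -[1+ m ] ℤ.- -[1+ j ]
      0≤c-d = ≡.subst (0ℤ ≤_) (≡.sym (ℤ.⊖-≥ (s≤s (ℕ.≮⇒≥ j≮m)))) (+≤+ z≤n)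

lemma2p2 : ∀ {c ℓ : Level} (R : CommutativeRing c ℓ) →
    let open CommutativeRing R in
    (A r : Carrier) (f : ℤ → ℤ → Carrier) →
    (∀ n k → f n k ≈ f (n ℤ.- 1ℤ) k + f (n ℤ.- 1ℤ) (k ℤ.- 1ℤ)) →
    (∀ d → f 0ℤ d ≈ A * δ₀ R d) →
    (∀ c′ → c′ < 0ℤ → f c′ 0ℤ ≈ A * r) →
    ∀ c′ d →
      ((0ℤ ≤ c′ → 0ℤ ≤ d → f c′ d ≈ A * ℤ⇒ R (binom c′ ∣ d ∣))
      × (c′ < 0ℤ → 0ℤ ≤ d → f c′ d ≈ (A * ℤ⇒ R (binom c′ ∣ d ∣)) * r)
      × (c′ < 0ℤ → 0ℤ ≤ c′ ℤ.- d →
           f c′ d ≈ (A * ℤ⇒ R (binom c′ ∣ c′ ℤ.- d ∣)) * (1# + (- r)))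
      × (¬ (0ℤ ≤ c′ × 0ℤ ≤ d) → ¬ (c′ < 0ℤ × 0ℤ ≤ d) → ¬ (c′ < 0ℤ × 0ℤ ≤ c′ ℤ.- d) →
           f c′ d ≈ 0#))
lemma2p2 R A r f f-rec f-row₀ f-column₀ c′ d =
  f≈binom c′ d , f≈binom*r c′ d , f≈binom*[1-r] c′ d , f≈0 c′ d
  where open Solution R A r f f-rec f-row₀ f-column₀
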